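{- Let $\Gamma$ be a context and let $\sigma$ be a (normalised) substitution consistent with $\Gamma$. If $\Gamma\vdash t:\vec q$ is derivable (for some cost), then $\vdash t\sigma:\vec q$ is derivable with the empty context.
   Context: Terms over $\mathcal{F}=\mathcal{C}\uplus\mathcal{D}$ and variables; substitutions are normalised, i.e. their ranges consist of ground normal forms of the TRS $\mathcal{R}\cup\mathcal{S}$ under consideration. Resource annotations: vectors of non-negative rationals (identified up to trailing zeros; componentwise order, sum, scaling). Annotation of an $n$-ary symbol: $\vec p_1\times\cdots\times\vec p_n\xrightarrow{k}\vec q$, $k\in\mathbb{Q}_{\ge0}$; an annotated signature gives each symbol a non-empty set $\mathcal{F}(f)$ of annotations (uniqueness and superposition for constructor and constructor-like symbols, i.e. defined symbols occurring in arguments of left-hand sides). Contexts: finite partial maps from variables to annotations. Judgements $\Gamma\vdash^k t:\vec q$ ($\Gamma\vdash t:\vec q$ when the cost is omitted) are derived by: (app) $x_1:\vec p_1,\dots,x_n:\vec p_n\vdash^k f(x_1,\dots,x_n):\vec q$ if $\vec p_1\times\cdots\times\vec p_n\xrightarrow{k}\vec q\in\mathcal{F}(f)$; (comp) from $x_1:\vec p_1,\dots,x_n:\vec p_n\vdash^{k_0}f(x_1,\dots,x_n):\vec q$ ($x_i$ fresh) and $\Gamma_i\vdash^{k_i}t_i:\vec p_i$ infer $\Gamma_1,\dots,\Gamma_n\vdash^{\sum_{i=0}^nk_i}f(t_1,\dots,t_n):\vec q$; (share) from $\Gamma,x:\vec r,y:\vec s\vdash^k t[x,y]:\vec q$ ($x,y$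 fresh) infer $\Gamma,z:\vec r+\vec s\vdash^k t[z,z]:\vec q$; (var) $x:\vec q\vdash^0x:\vec q$; (w1) from $\Gamma\vdash^k t:\vec q$, $k'\ge k$ infer $\Gamma\vdash^{k'}t:\vec q$; (w2) from $\Gamma,x:\vec r\vdash^kt:\vec q$, $\vec p\ge\vec r$ infer $\Gamma,x:\vec p\vdash^kt:\vec q$; (w3) from $\Gamma\vdash^kt:\vec s$, $\vec s\ge\vec q$ infer $\Gamma\vdash^kt:\vec q$; (w4) from $\Gamma\vdash^kt:\vec q$ infer $\Gamma,x:\vec p\vdash^kt:\vec q$. A substitution $\sigma$ is consistent with $\Gamma$ if for all $x\in\mathrm{dom}(\sigma)$, whenever $\Gamma\vdash x:\vec q$ then $\vdash x\sigma:\vec q$. -}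

module Defs where

open import Data.Nat as ℕ using (ℕ; zero; suc)
open import Data.Fin as Fin using (Fin)
open import Data.Vec as Vec using (Vec; lookup; _[_]≔_)
import Data.Vec
open import Data.List using (List; []; _∷_)
open import Data.List.Membership.Propositional using (_∈_)
open import Data.Maybe using (Maybe; just; nothing)
open import Data.Bool using (Bool; true; false)
open import Data.Product using (Σ; Σ-syntax; _×_; _,_)
open import Data.Sum using (_⊎_)
open import Data.Unit using (⊤)
open import Data.Empty using (⊥)
open import Relation.Nullary using (¬_)
open import Relation.Binary.PropositionalEquality using (_≡_; _≢_)
import Data.Rational as ℚ
open import Data.Rational using (ℚ; NonNegative)
import Data.Rational.Properties as ℚP

-- Non-negative rationals ℚ≥0 (proof field irrelevant, so equality is
-- equality of the underlying rational).

record ℚ≥0 : Set where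
  constructor ⟨_⟩≥0
  field
    val : ℚ
    .{{nonneg}} : NonNegative val
open ℚ≥0 public

0q : ℚ≥0
0q = ⟨ ℚ.0ℚ ⟩≥0

_+q_ : ℚ≥0 → ℚ≥0 → ℚ≥0
(⟨ a ⟩≥0) +q (⟨ b ⟩≥0) = record { val = a ℚ.+ b ; nonneg = ℚP.nonNeg+nonNeg⇒nonNeg a b }

_*q_ : ℚ≥0 → ℚ≥0 → ℚ≥0
(⟨ a ⟩≥0) *q (⟨ b ⟩≥0) = record { val = a ℚ.* b ; nonneg = ℚP.nonNeg*nonNeg⇒nonNeg a b }

_≤q_ : ℚ≥0 → ℚ≥0 → Set
a ≤q b = val a ℚ.≤ val b

-- Resource annotations: finite vectors of non-negative rationals,
-- identified up to trailing zeros (missing components count as 0).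

Res : Set
Res = List ℚ≥0

_≤ᵣ_ : Res → Res → Set
[]       ≤ᵣ _        = ⊤
(a ∷ as) ≤ᵣ []       = (a ≤q 0q) × (as ≤ᵣ [])
(a ∷ as) ≤ᵣ (b ∷ bs) = (a ≤q b) × (as ≤ᵣ bs)

_≈ᵣ_ : Res → Res → Set
p ≈ᵣ q = (p ≤ᵣ q) × (q ≤ᵣ p)

_⊕_ : Res → Res → Res
[]       ⊕ bs       = bs
(a ∷ as) ⊕ []       = a ∷ as
(a ∷ as) ⊕ (b ∷ bs) = (a +q b) ∷ (as ⊕ bs)

_·ᵣ_ : ℚ≥0 → Res → Res
λ' ·ᵣ []       = []
λ' ·ᵣ (a ∷ as) = (λ' *q a) ∷ (λ' ·ᵣ as)

Vec≈ : ∀ {n} → Vec Res n → Vec Res n → Set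
Vec≈ {n} ps qs = (i : Fin n) → lookup ps i ≈ᵣ lookup qs i

vzip⊕ : ∀ {n} → Vec Res n → Vec Res n → Vec Res n
vzip⊕ = Data.Vec.zipWith _⊕_

vscale : ∀ {n} → ℚ≥0 → Vec Res n → Vec Res n
vscale λ' = Data.Vec.map (λ' ·ᵣ_)

record Signature : Set₁ where
  field
    Sym   : Set
    arity : Sym → ℕ
    isConstructor : Sym → Bool   -- true: f ∈ C, false: f ∈ D
open Signature public

Var : Set
Var = ℕ

module _ {S : Signature} where

  data Term : Set where
    var : Var → Term
    app : (f : Sym S) → Vec Term (arity S f) → Term

  Subst : Set
  Subst = Var → Term

  mutual
    _⟨_⟩ : Term → Subst → Term
    var x    ⟨ σ ⟩ = σ x
    app f ts ⟨ σ ⟩ = app f (substs ts σ)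

    substs : ∀ {n} → Vec Term n → Subst → Vec Term n
    substs Vec.[]       σ = Vec.[]
    substs (t Vec.∷ ts) σ = (t ⟨ σ ⟩) Vec.∷ substs ts σ

  data _occursIn_ (x : Var) : Term → Set where
    here  : x occursIn var x
    there : ∀ {f ts} (i : Fin (arity S f)) → x occursIn lookup ts i → x occursIn app f ts

  Ground : Term → Set
  Ground t = ∀ x → ¬ (x occursIn t)

  data _symOccursIn_ (g : Sym S) : Term → Set where
    here  : ∀ {ts} → g symOccursIn app g ts
    there : ∀ {f ts} (i : Fin (arity S f)) → g symOccursIn lookup ts i → g symOccursIn app f ts

  TRS : Set
  TRS = List (Term × Term)

  data Step (R : TRS) : Term → Term → Set where
    root : ∀ {l r} (σ : Subst) → (l , r) ∈ R → Step R (l ⟨ σ ⟩) (r ⟨ σ ⟩)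
    arg  : ∀ {f ts u} (i : Fin (arity S f)) → Step R (lookup ts i) u →
           Step R (app f ts) (app f (ts [ i ]≔ u))

  NormalForm : TRS → Term → Set
  NormalForm R t = ∀ u → ¬ Step R t u

  Normalised : TRS → Subst → Set
  Normalised R σ = ∀ x → Ground (σ x) × NormalForm R (σ x)

  ConstructorLike : TRS → Sym S → Set
  ConstructorLike R g =
    (isConstructor S g ≡ false) ×
    Σ[ f ∈ Sym S ] Σ[ ls ∈ Vec Term (arity S f) ] Σ[ r ∈ Term ]
      (((app f ls , r) ∈ R) × Σ[ i ∈ Fin (arity S f) ] (g symOccursIn lookup ls i))

  -- Annotated signatures.  F f ps k q  means  ps₁ × … × psₙ --k--> q ∈ F(f)

  record AnnSig (R : TRS) : Set₁ where
    field
      F : (f : Sym S) → Vec Res (arity S f) → ℚ≥0 → Res → Set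
      nonempty : ∀ f → Σ[ ps ∈ Vec Res (arity S f) ] Σ[ k ∈ ℚ≥0 ] Σ[ q ∈ Res ] F f ps k q
      uniqueness : ∀ f → (isConstructor S f ≡ true ⊎ ConstructorLike R f) →
        ∀ {ps ps' k k' q q'} → F f ps k q → F f ps' k' q' → q ≈ᵣ q' →
        Vec≈ ps ps' × (k ≤q k' × k' ≤q k)
      superposition-+ : ∀ f → (isConstructor S f ≡ true ⊎ ConstructorLike R f) →
        ∀ {ps ps' k k' q q'} → F f ps k q → F f ps' k' q' →
        F f (vzip⊕ ps ps') (k +q k') (q ⊕ q')
      superposition-· : ∀ f → (isConstructor S f ≡ true ⊎ ConstructorLike R f) →
        ∀ (λ' : ℚ≥0) {ps k q} → F f ps k q →
        F f (vscale λ' ps) (λ' *q k) (λ' ·ᵣ q)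
  open AnnSig public

  -- Contexts: partial maps from variables to annotations.
  -- Rules state the shape of the conclusion context pointwise.

  Ctx : Set
  Ctx = Var → Maybe Res

  ∅ : Ctx
  ∅ _ = nothing

  Distinct : ∀ {n} → Vec Var n → Set
  Distinct xs = ∀ i j → lookup xs i ≡ lookup xs j → i ≡ j

  IsCtxOf : ∀ {n} → Ctx → Vec Var n → Vec Res n → Set
  IsCtxOf {n} Γ xs ps =
    Distinct xs ×
    ((i : Fin n) → Γ (lookup xs i) ≡ just (lookup ps i)) ×
    (∀ y → (∀ i → y ≢ lookup xs i) → Γ y ≡ nothing)

  IsDisjUnion : ∀ {n} → (Fin n → Ctx) → Ctx → Set
  IsDisjUnion {n} Γs Γ = ∀ x →
      (Γ x ≡ nothing × (∀ i → Γs i x ≡ nothing))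
    ⊎ (Σ[ i ∈ Fin n ] Σ[ p ∈ Res ]
         (Γ x ≡ just p × Γs i x ≡ just p × (∀ j → j ≢ i → Γs j x ≡ nothing)))

  IsExt : Ctx → Var → Res → Ctx → Set
  IsExt Γ x p Δ = Γ x ≡ nothing × Δ x ≡ just p × (∀ w → w ≢ x → Δ w ≡ Γ w)

  sumFin : ∀ {n} → (Fin n → ℚ≥0) → ℚ≥0
  sumFin {zero}  ks = 0q
  sumFin {suc n} ks = ks Fin.zero +q sumFin (λ i → ks (Fin.suc i))

  varsOf : ∀ {n} → Vec Var n → Vec Term n
  varsOf = Data.Vec.map var

  merge : Var → Var → Var → Var → Var
  merge x y z w with w ℕ.≟ x | w ℕ.≟ y
  ... | Relation.Nullary.yes _ | _ = z
  ... | Relation.Nullary.no _ | Relation.Nullary.yes _ = z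
  ... | Relation.Nullary.no _ | Relation.Nullary.no _ = w

  module _ {R : TRS} (A : AnnSig R) where

    data _⊢[_]_∶_ : Ctx → ℚ≥0 → Term → Res → Set where
      app-rule : ∀ {Γ f k q} {xs : Vec Var (arity S f)} {ps : Vec Res (arity S f)} →
        F A f ps k q → IsCtxOf Γ xs ps →
        Γ ⊢[ k ] app f (varsOf xs) ∶ q
      comp : ∀ {Γ₀ Γ f k₀ q} {xs : Vec Var (arity S f)} {ps : Vec Res (arity S f)}
               {ts : Vec Term (arity S f)} {Γs : Fin (arity S f) → Ctx}
               {ks : Fin (arity S f) → ℚ≥0} →
        IsCtxOf Γ₀ xs ps →
        Γ₀ ⊢[ k₀ ] app f (varsOf xs) ∶ q →
        ((i : Fin (arity S f)) → Γs i ⊢[ ks i ] lookup ts i ∶ lookup ps i) →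
        IsDisjUnion Γs Γ →
        Γ ⊢[ k₀ +q sumFin ks ] app f ts ∶ q
      share : ∀ {Γ' Δ k t q r s} {x y z : Var} →
        x ≢ y → Γ' x ≡ just r → Γ' y ≡ just s →
        -- z ∉ dom Γ, where Γ is Γ' without x and y
        (z ≢ x → z ≢ y → Γ' z ≡ nothing) →
        Δ z ≡ just (r ⊕ s) →
        (∀ w → w ≢ z → w ≢ x → w ≢ y → Δ w ≡ Γ' w) →
        (∀ w → w ≢ z → (w ≡ x ⊎ w ≡ y) → Δ w ≡ nothing) →
        Γ' ⊢[ k ] t ∶ q →
        Δ ⊢[ k ] (t ⟨ (λ w → var (merge x y z w)) ⟩) ∶ q
      var-rule : ∀ {Γ x q} → IsCtxOf Γ (x Vec.∷ Vec.[]) (q Vec.∷ Vec.[]) →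
        Γ ⊢[ 0q ] var x ∶ q
      w1 : ∀ {Γ k k' t q} → Γ ⊢[ k ] t ∶ q → k ≤q k' → Γ ⊢[ k' ] t ∶ q
      w2 : ∀ {Γ' Δ k t q r p} {x : Var} →
        Γ' ⊢[ k ] t ∶ q → Γ' x ≡ just r → Δ x ≡ just p → r ≤ᵣ p →
        (∀ w → w ≢ x → Δ w ≡ Γ' w) →
        Δ ⊢[ k ] t ∶ q
      w3 : ∀ {Γ k t q s} → Γ ⊢[ k ] t ∶ s → q ≤ᵣ s → Γ ⊢[ k ] t ∶ q
      w4 : ∀ {Γ Δ k t q p} {x : Var} →
        Γ ⊢[ k ] t ∶ q → IsExt Γ x p Δ → Δ ⊢[ k ] t ∶ q

    _⊢_∶_ : Ctx → Term → Res → Set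
    Γ ⊢ t ∶ q = Σ[ k ∈ ℚ≥0 ] (Γ ⊢[ k ] t ∶ q)

    Consistent : Subst → Ctx → Set
    Consistent σ Γ = ∀ x q → Γ ⊢ var x ∶ q → ∅ ⊢ σ x ∶ q

module Submission where

open import Defs
open import Data.Product using (Σ; Σ-syntax; _×_; _,_; proj₁; proj₂)
open import Data.Nat as ℕ using (ℕ; zero; suc; _<_; _+_)
import Data.Nat.Properties as ℕP
open import Data.Fin as Fin using (Fin)
import Data.Fin.Properties as FinP
open import Data.Vec as Vec using (Vec; lookup)
import Data.Vec.Properties as VecP
open import Data.Maybe using (Maybe; just; nothing)
open import Data.List using ([]; _∷_)
open import Data.Sum using (_⊎_; inj₁; inj₂)
open import Data.Unit using (tt)
open import Data.Empty using (⊥-elim)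
open import Function using (id; _∘_)
open import Relation.Nullary using (¬_; yes; no)
open import Relation.Binary.PropositionalEquality
import Data.Rational.Properties as ℚP

-- The core is a substitution theorem proved by induction on the derivation
-- of Γ ⊢ t : q under the hypothesis "σ is closed-typed on Γ": for every
-- declaration x:p in Γ we have ⊢ σx : p.  The leaves (app), (var) become an
-- instance of (comp) with closed arguments; (share) is handled by composing
-- σ with the renaming t[x,y] ↦ t[z,z]; the weakening rules only move the
-- hypothesis along an embedding of contexts, using (w3) to lower annotations.
--
-- Consistency of σ with Γ talks about judgements Γ ⊢ var x : p, so to get
-- closed-typedness we must derive Γ ⊢ var x : Γ(x) from the singleton
-- context x:Γ(x) by finitely many (w4) steps.  This needs dom Γ to be
-- finite, which holds for every context of a derivable judgement: this is
-- the boundedness lemma below.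

≤q-+ʳ : ∀ a b → a ≤q (a +q b)
≤q-+ʳ ⟨ a ⟩≥0 ⟨ b ⟩≥0 =
  ℚP.≤-trans (ℚP.≤-reflexive (sym (ℚP.+-identityʳ a))) (ℚP.+-monoʳ-≤ a (ℚP.nonNegative⁻¹ b))

≤q-+ˡ : ∀ a b → b ≤q (a +q b)
≤q-+ˡ ⟨ a ⟩≥0 ⟨ b ⟩≥0 =
  ℚP.≤-trans (ℚP.≤-reflexive (sym (ℚP.+-identityˡ b))) (ℚP.+-monoˡ-≤ b (ℚP.nonNegative⁻¹ a))

≤ᵣ-refl : ∀ r → r ≤ᵣ r
≤ᵣ-refl []       = tt
≤ᵣ-refl (a ∷ as) = ℚP.≤-refl , ≤ᵣ-refl as

≤ᵣ-⊕ʳ : ∀ r s → r ≤ᵣ (r ⊕ s)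
≤ᵣ-⊕ʳ []       s        = tt
≤ᵣ-⊕ʳ (a ∷ as) []       = ≤ᵣ-refl (a ∷ as)
≤ᵣ-⊕ʳ (a ∷ as) (b ∷ bs) = ≤q-+ʳ a b , ≤ᵣ-⊕ʳ as bs

≤ᵣ-⊕ˡ : ∀ r s → s ≤ᵣ (r ⊕ s)
≤ᵣ-⊕ˡ r        []       = tt
≤ᵣ-⊕ˡ []       (b ∷ bs) = ≤ᵣ-refl (b ∷ bs)
≤ᵣ-⊕ˡ (a ∷ as) (b ∷ bs) = ≤q-+ˡ a b , ≤ᵣ-⊕ˡ as bs

sumN : ∀ {n} → (Fin n → ℕ) → ℕ
sumN {zero}  f = 0
sumN {suc n} f = f Fin.zero + sumN (f ∘ Fin.suc)

sumN-upper : ∀ {n} (f : Fin n → ℕ) i → f i ℕ.≤ sumN f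
sumN-upper f Fin.zero    = ℕP.m≤m+n (f Fin.zero) _
sumN-upper f (Fin.suc i) = ℕP.≤-trans (sumN-upper (f ∘ Fin.suc) i) (ℕP.m≤n+m _ (f Fin.zero))

just≢nothing : ∀ {A : Set} {a : A} → just a ≢ nothing
just≢nothing ()

-- Contexts as partial maps.  Ctx {S} unfolds to Context for every
-- signature S, so these notions are stated once, independently of S.

Context : Set
Context = Var → Maybe Res

_⊆_ : Context → Context → Set
Γ₁ ⊆ Γ = ∀ w p → Γ₁ w ≡ just p → Γ w ≡ just p

⊆-undefined : ∀ {Γ₁ Γ : Context} {w} → Γ₁ ⊆ Γ → Γ w ≡ nothing → Γ₁ w ≡ nothing
⊆-undefined {Γ₁} {w = w} Γ₁⊆Γ undef with Γ₁ w in e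
... | just p  = ⊥-elim (just≢nothing (trans (sym (Γ₁⊆Γ w p e)) undef))
... | nothing = refl

Embeds : (Var → Var) → Context → Context → Set
Embeds ρ Γ' Δ = ∀ w p → Γ' w ≡ just p → Σ[ p' ∈ Res ] (Δ (ρ w) ≡ just p' × p ≤ᵣ p')

⊆⇒embeds : ∀ {Γ' Δ : Context} → Γ' ⊆ Δ → Embeds id Γ' Δ
⊆⇒embeds Γ'⊆Δ w p e = p , Γ'⊆Δ w p e , ≤ᵣ-refl p

raise-embeds : ∀ {Γ' Δ : Context} {x r p} → Γ' x ≡ just r → Δ x ≡ just p → r ≤ᵣ p →
  (∀ w → w ≢ x → Δ w ≡ Γ' w) → Embeds id Γ' Δ
raise-embeds {x = x} {p = p} Γ'x Δx r≤p rest w p' e with w ℕ.≟ x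
... | yes refl with trans (sym Γ'x) e
...   | refl = p , Δx , r≤p
raise-embeds Γ'x Δx r≤p rest w p' e | no w≢x = p' , trans (rest w w≢x) e , ≤ᵣ-refl p'

Bounded : Context → ℕ → Set
Bounded Γ N = ∀ y p → Γ y ≡ just p → y < N

outside-bound : ∀ {Γ : Context} {N w} → Bounded Γ N → ¬ (w < N) → Γ w ≡ nothing
outside-bound {Γ} {w = w} bounded w≮N with Γ w in e
... | just p  = ⊥-elim (w≮N (bounded w p e))
... | nothing = refl

bounded-except : ∀ {Γ Δ : Context} {N} x → Bounded Γ N →
  (∀ w p → w ≢ x → Δ w ≡ just p → Γ w ≡ just p) → Bounded Δ (suc x + N)
bounded-except {N = N} x bounded Δ⊆Γ w p e with w ℕ.≟ x
... | yes refl = ℕP.m≤m+n (suc x) N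
... | no w≢x   = ℕP.<-≤-trans (bounded w p (Δ⊆Γ w p w≢x e)) (ℕP.m≤n+m N (suc x))

module _ {S : Signature} where

  mutual
    ⟨⟩-∘ : (t : Term {S}) (ρ σ : Subst {S}) → (t ⟨ ρ ⟩) ⟨ σ ⟩ ≡ t ⟨ (λ w → ρ w ⟨ σ ⟩) ⟩
    ⟨⟩-∘ (var x)    ρ σ = refl
    ⟨⟩-∘ (app f ts) ρ σ = cong (app f) (substs-∘ ts ρ σ)

    substs-∘ : ∀ {n} (ts : Vec (Term {S}) n) (ρ σ : Subst {S}) →
      substs (substs ts ρ) σ ≡ substs ts (λ w → ρ w ⟨ σ ⟩)
    substs-∘ Vec.[]       ρ σ = refl
    substs-∘ (t Vec.∷ ts) ρ σ = cong₂ Vec._∷_ (⟨⟩-∘ t ρ σ) (substs-∘ ts ρ σ)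

  lookup-substs : ∀ {n} (ts : Vec (Term {S}) n) (σ : Subst {S}) i →
    lookup (substs ts σ) i ≡ lookup ts i ⟨ σ ⟩
  lookup-substs (t Vec.∷ ts) σ Fin.zero    = refl
  lookup-substs (t Vec.∷ ts) σ (Fin.suc i) = lookup-substs ts σ i

  lookup-substs-vars : ∀ {n} (xs : Vec Var n) (σ : Subst {S}) i →
    lookup (substs (varsOf xs) σ) i ≡ σ (lookup xs i)
  lookup-substs-vars xs σ i =
    trans (lookup-substs (varsOf xs) σ i) (cong (_⟨ σ ⟩) (VecP.lookup-map i var xs))

  ctxOf-cong : ∀ {n Γ Γ'} {xs : Vec Var n} {ps} → (∀ w → Γ w ≡ Γ' w) → IsCtxOf {S} Γ xs ps → IsCtxOf {S} Γ' xs ps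
  ctxOf-cong eq (distinct , decl , only) =
    distinct , (λ i → trans (sym (eq _)) (decl i)) , λ y y∉xs → trans (sym (eq y)) (only y y∉xs)

  disjUnion-cong : ∀ {n} {Γs : Fin n → Context} {Γ Γ'} → (∀ w → Γ w ≡ Γ' w) →
    IsDisjUnion {S} Γs Γ → IsDisjUnion {S} Γs Γ'
  disjUnion-cong eq du x with du x
  ... | inj₁ (undef , parts)           = inj₁ (trans (sym (eq x)) undef , parts)
  ... | inj₂ (j , p , e , eⱼ , others) = inj₂ (j , p , trans (sym (eq x)) e , eⱼ , others)

  union-⊆ : ∀ {n} {Γs : Fin n → Context} {Γ} → IsDisjUnion {S} Γs Γ → ∀ i → Γs i ⊆ Γ
  union-⊆ du i x p e with du x
  ... | inj₁ (_ , undef) = ⊥-elim (just≢nothing (trans (sym e) (undef i)))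
  ... | inj₂ (j , p' , e₁ , e₂ , others) with i FinP.≟ j
  ...   | yes refl = trans e₁ (trans (sym e₂) e)
  ...   | no i≢j   = ⊥-elim (just≢nothing (trans (sym e) (others i i≢j)))

  ext-⊆ : ∀ {Γ Δ : Context} {x p} → IsExt {S} Γ x p Δ → Γ ⊆ Δ
  ext-⊆ {x = x} (undef , _ , rest) w p e with w ℕ.≟ x
  ... | yes refl = ⊥-elim (just≢nothing (trans (sym e) undef))
  ... | no w≢x   = trans (rest w w≢x) e

  merge-embeds : ∀ {Γ' Δ : Context} {x y z r s} → Γ' x ≡ just r → Γ' y ≡ just s →
    (z ≢ x → z ≢ y → Γ' z ≡ nothing) → Δ z ≡ just (r ⊕ s) →
    (∀ w → w ≢ z → w ≢ x → w ≢ y → Δ w ≡ Γ' w) →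
    Embeds (merge {S} x y z) Γ' Δ
  merge-embeds {x = x} {y} {z} {r} {s} Γ'x Γ'y z-fresh Δz rest w p e with w ℕ.≟ x | w ℕ.≟ y
  ... | yes refl | _ with trans (sym Γ'x) e
  ...   | refl = r ⊕ s , Δz , ≤ᵣ-⊕ʳ r s
  merge-embeds {r = r} {s} Γ'x Γ'y z-fresh Δz rest w p e | no _ | yes refl with trans (sym Γ'y) e
  ...   | refl = r ⊕ s , Δz , ≤ᵣ-⊕ˡ r s
  merge-embeds {z = z} Γ'x Γ'y z-fresh Δz rest w p e | no w≢x | no w≢y with w ℕ.≟ z
  ...   | yes refl = ⊥-elim (just≢nothing (trans (sym e) (z-fresh w≢x w≢y)))
  ...   | no w≢z   = p , trans (rest w w≢z w≢x w≢y) e , ≤ᵣ-refl p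

  bounded-ctxOf : ∀ {n} {Γ : Context} (xs : Vec Var n) {ps} → IsCtxOf {S} Γ xs ps → Σ ℕ (Bounded Γ)
  bounded-ctxOf xs (_ , _ , only-xs) = N , bounded
    where
      N : ℕ
      N = sumN (λ i → suc (lookup xs i))
      bounded : Bounded _ N
      bounded y p e with y ℕP.<? N
      ... | yes y<N = y<N
      ... | no y≮N  = ⊥-elim (just≢nothing (trans (sym e) (only-xs y λ i y≡xᵢ →
              y≮N (subst (_< N) (sym y≡xᵢ) (sumN-upper (λ j → suc (lookup xs j)) i)))))

  bounded-union : ∀ {n} {Γs : Fin n → Context} {Γ} (Ns : Fin n → ℕ) →
    (∀ i → Bounded (Γs i) (Ns i)) → IsDisjUnion {S} Γs Γ → Bounded Γ (sumN Ns)
  bounded-union Ns bounded du y p e with du y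
  ... | inj₁ (undef , _)          = ⊥-elim (just≢nothing (trans (sym e) undef))
  ... | inj₂ (j , p' , _ , e' , _) = ℕP.<-≤-trans (bounded j y p' e') (sumN-upper Ns j)

  module _ {R : TRS {S}} (A : AnnSig R) where

    _⊢ᴬ[_]_∶_ : Context → ℚ≥0 → Term {S} → Res → Set
    _⊢ᴬ[_]_∶_ = _⊢[_]_∶_ A

    _⊢ᴬ_∶_ : Context → Term {S} → Res → Set
    _⊢ᴬ_∶_ = _⊢_∶_ A

    derivable⇒bounded : ∀ {Γ k t q} → Γ ⊢ᴬ[ k ] t ∶ q → Σ ℕ (Bounded Γ)
    derivable⇒bounded (app-rule {xs = xs} {ps} _ ic) = bounded-ctxOf xs {ps} ic
    derivable⇒bounded (var-rule {x = x} {q} ic) = bounded-ctxOf (x Vec.∷ Vec.[]) {q Vec.∷ Vec.[]} ic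
    derivable⇒bounded (comp {Γs = Γs} _ _ ds du) = sumN Ns , bounded-union Ns (proj₂ ∘ bound) du
      where
        bound : ∀ i → Σ ℕ (Bounded (Γs i))
        bound i = derivable⇒bounded (ds i)
        Ns : Fin _ → ℕ
        Ns = proj₁ ∘ bound
    derivable⇒bounded (share {Γ'} {Δ} {x = x} {y} {z} _ _ _ _ _ rest gone d) =
      _ , bounded-except z (proj₂ (derivable⇒bounded d)) Δ⊆Γ'
      where
        Δ⊆Γ' : ∀ w p → w ≢ z → Δ w ≡ just p → Γ' w ≡ just p
        Δ⊆Γ' w p w≢z e with w ℕ.≟ x | w ℕ.≟ y
        ... | yes w≡x | _       = ⊥-elim (just≢nothing (trans (sym e) (gone w w≢z (inj₁ w≡x))))
        ... | no _    | yes w≡y = ⊥-elim (just≢nothing (trans (sym e) (gone w w≢z (inj₂ w≡y))))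
        ... | no w≢x  | no w≢y  = trans (sym (rest w w≢z w≢x w≢y)) e
    derivable⇒bounded (w1 d _) = derivable⇒bounded d
    derivable⇒bounded (w3 d _) = derivable⇒bounded d
    derivable⇒bounded (w2 {x = x} d _ _ _ rest) =
      _ , bounded-except x (proj₂ (derivable⇒bounded d)) (λ w p w≢x e → trans (sym (rest w w≢x)) e)
    derivable⇒bounded (w4 {x = x} d (_ , _ , rest)) =
      _ , bounded-except x (proj₂ (derivable⇒bounded d)) (λ w p w≢x e → trans (sym (rest w w≢x)) e)

    ctx-cong : ∀ {Γ Γ' k t q} → (∀ w → Γ w ≡ Γ' w) → Γ ⊢ᴬ[ k ] t ∶ q → Γ' ⊢ᴬ[ k ] t ∶ q
    ctx-cong eq (app-rule {xs = xs} {ps} Ff ic) = app-rule Ff (ctxOf-cong {xs = xs} {ps} eq ic)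
    ctx-cong eq (var-rule {x = x} {q} ic) = var-rule (ctxOf-cong {xs = x Vec.∷ Vec.[]} {q Vec.∷ Vec.[]} eq ic)
    ctx-cong eq (comp {xs = xs} {ps} {Γs = Γs} ic d₀ ds du) =
      comp {xs = xs} {ps} {Γs = Γs} ic d₀ ds (disjUnion-cong eq du)
    ctx-cong eq (share x≢y Γ'x Γ'y z-fresh Δz rest gone d) =
      share x≢y Γ'x Γ'y z-fresh (trans (sym (eq _)) Δz)
        (λ w a b c → trans (sym (eq w)) (rest w a b c)) (λ w a b → trans (sym (eq w)) (gone w a b)) d
    ctx-cong eq (w1 d k≤k') = w1 (ctx-cong eq d) k≤k'
    ctx-cong eq (w2 d Γ'x Δx r≤p rest) =
      w2 d Γ'x (trans (sym (eq _)) Δx) r≤p (λ w ne → trans (sym (eq w)) (rest w ne))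
    ctx-cong eq (w3 d q≤s) = w3 (ctx-cong eq d) q≤s
    ctx-cong eq (w4 d (undef , Δx , rest)) =
      w4 d (undef , trans (sym (eq _)) Δx , λ w ne → trans (sym (eq w)) (rest w ne))

    redefine-at : ∀ {Γ Δ k t q} x → (∀ w → w ≢ x → Δ w ≡ Γ w) → Γ x ≡ nothing ⊎ Γ x ≡ Δ x →
      Γ ⊢ᴬ[ k ] t ∶ q → Δ ⊢ᴬ[ k ] t ∶ q
    redefine-at {Γ} {Δ} x rest (inj₂ same) d = ctx-cong agree d
      where
        agree : ∀ w → Γ w ≡ Δ w
        agree w with w ℕ.≟ x
        ... | yes refl = same
        ... | no w≢x   = sym (rest w w≢x)
    redefine-at {Δ = Δ} x rest (inj₁ undef) d with Δ x in Δx
    ... | just p  = w4 d (undef , Δx , rest)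
    ... | nothing = redefine-at x rest (inj₂ (trans undef (sym Δx))) d

    -- weakening from Γ₁ to a bounded Γ ⊇ Γ₁, one variable below the bound at a time
    module Weakening {Γ₁ Γ : Context} (Γ₁⊆Γ : Γ₁ ⊆ Γ) where

      between : ℕ → Context
      between zero    w = Γ₁ w
      between (suc N) w with w ℕ.≟ N
      ... | yes _ = Γ w
      ... | no _  = between N w

      between-⊆ : ∀ N → between N ⊆ Γ
      between-⊆ zero    w p e = Γ₁⊆Γ w p e
      between-⊆ (suc N) w p e with w ℕ.≟ N
      ... | yes _ = e
      ... | no _  = between-⊆ N w p e

      between-below : ∀ N w → w < N → between N w ≡ Γ w
      between-below (suc N) w w<N with w ℕ.≟ N
      ... | yes _  = refl
      ... | no w≢N = between-below N w (ℕP.≤∧≢⇒< (ℕP.≤-pred w<N) w≢N)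

      between-rest : ∀ N w → w ≢ N → between (suc N) w ≡ between N w
      between-rest N w w≢N with w ℕ.≟ N
      ... | yes w≡N = ⊥-elim (w≢N w≡N)
      ... | no _    = refl

      between-step : ∀ {k t q} N → between N ⊢ᴬ[ k ] t ∶ q → between (suc N) ⊢ᴬ[ k ] t ∶ q
      between-step N d with between N N in e
      ... | nothing = redefine-at N (between-rest N) (inj₁ e) d
      ... | just p  = redefine-at N (between-rest N) (inj₂ unchanged) d
        where
          unchanged : between N N ≡ between (suc N) N
          unchanged = begin
            between N N       ≡⟨ e ⟩
            just p            ≡⟨ between-⊆ N N p e ⟨
            Γ N               ≡⟨ between-below (suc N) N (ℕP.n<1+n N) ⟨
            between (suc N) N ∎
            where open ≡-Reasoning

      between-all : ∀ {k t q} N → Γ₁ ⊢ᴬ[ k ] t ∶ q → between N ⊢ᴬ[ k ] t ∶ q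
      between-all zero    d = d
      between-all (suc N) d = between-step N (between-all N d)

      weaken : ∀ {k t q} N → Bounded Γ N → Γ₁ ⊢ᴬ[ k ] t ∶ q → Γ ⊢ᴬ[ k ] t ∶ q
      weaken N bounded d = ctx-cong agree (between-all N d)
        where
          agree : ∀ w → between N w ≡ Γ w
          agree w with w ℕP.<? N
          ... | yes w<N = between-below N w w<N
          ... | no w≮N  = trans (⊆-undefined (between-⊆ N) undef) (sym undef)
            where
              undef : Γ w ≡ nothing
              undef = outside-bound bounded w≮N

    singleton : Var → Res → Context
    singleton x p w with w ℕ.≟ x
    ... | yes _ = just p
    ... | no _  = nothing

    singleton-isCtx : ∀ x p → IsCtxOf {S} (singleton x p) (x Vec.∷ Vec.[]) (p Vec.∷ Vec.[])
    singleton-isCtx x p = (λ { Fin.zero Fin.zero _ → refl }) , (λ { Fin.zero → declared }) , only-x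
      where
        declared : singleton x p x ≡ just p
        declared with x ℕ.≟ x
        ... | yes _  = refl
        ... | no x≢x = ⊥-elim (x≢x refl)
        only-x : ∀ y → (∀ i → y ≢ lookup (x Vec.∷ Vec.[]) i) → singleton x p y ≡ nothing
        only-x y y≢x with y ℕ.≟ x
        ... | yes y≡x = ⊥-elim (y≢x Fin.zero y≡x)
        ... | no _    = refl

    singleton-⊆ : ∀ {Γ : Context} {x p} → Γ x ≡ just p → singleton x p ⊆ Γ
    singleton-⊆ {x = x} Γx w p' e with w ℕ.≟ x
    singleton-⊆ Γx w p' refl | yes refl = Γx

    var-typed : ∀ {Γ : Context} {N x p} → Bounded Γ N → Γ x ≡ just p → Γ ⊢ᴬ[ 0q ] var x ∶ p
    var-typed {N = N} {x} {p} bounded Γx =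
      Weakening.weaken (singleton-⊆ Γx) N bounded (var-rule (singleton-isCtx x p))

    ClosedTyped : Subst {S} → Context → Set
    ClosedTyped σ Γ = ∀ x p → Γ x ≡ just p → ∅ {S} ⊢ᴬ σ x ∶ p

    consistent⇒closedTyped : ∀ {Γ : Context} {N σ} → Bounded Γ N → Consistent A σ Γ → ClosedTyped σ Γ
    consistent⇒closedTyped bounded consistent x p Γx = consistent x p (0q , var-typed bounded Γx)

    closedTyped-embed : ∀ {Γ' Δ : Context} {ρ σ} → Embeds ρ Γ' Δ → ClosedTyped σ Δ → ClosedTyped (σ ∘ ρ) Γ'
    closedTyped-embed embeds closed x p Γ'x with embeds x p Γ'x
    ... | p' , Δρx , p≤p' with closed _ p' Δρx
    ...   | k , d = k , w3 d p≤p'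

    retype : ∀ {u v q} → u ≡ v → ∅ {S} ⊢ᴬ v ∶ q → ∅ {S} ⊢ᴬ u ∶ q
    retype u≡v = subst (λ w → ∅ {S} ⊢ᴬ w ∶ _) (sym u≡v)

    comp-closed : ∀ {Γ₀ f k₀ q} {xs : Vec Var (arity S f)} {ps} {us : Vec Term (arity S f)} →
      IsCtxOf {S} Γ₀ xs ps → Γ₀ ⊢ᴬ[ k₀ ] app f (varsOf xs) ∶ q →
      (∀ i → ∅ {S} ⊢ᴬ lookup us i ∶ lookup ps i) → ∅ {S} ⊢ᴬ app f us ∶ q
    comp-closed {xs = xs} {ps} {us} ic d₀ args =
      _ , comp {xs = xs} {ps} {us} {λ _ → ∅ {S}} {proj₁ ∘ args} ic d₀ (proj₂ ∘ args) (λ _ → inj₁ (refl , λ _ → refl))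

    substitution : ∀ {Γ k t q} (σ : Subst {S}) → Γ ⊢ᴬ[ k ] t ∶ q → ClosedTyped σ Γ → ∅ {S} ⊢ᴬ t ⟨ σ ⟩ ∶ q
    substitution σ (app-rule {xs = xs} {ps} Ff ic) closed =
      comp-closed {xs = xs} {ps} ic (app-rule Ff ic) λ i →
        retype (lookup-substs-vars xs σ i) (closed _ _ (proj₁ (proj₂ ic) i))
    substitution σ (comp {xs = xs} {ps} {ts} ic d₀ ds du) closed =
      comp-closed {xs = xs} {ps} ic d₀ λ i →
        retype (lookup-substs ts σ i) (substitution σ (ds i) (closedTyped-embed (⊆⇒embeds (union-⊆ du i)) closed))
    substitution σ (share {t = t} {x = x} {y} {z} _ Γ'x Γ'y z-fresh Δz rest _ d) closed =
      retype (⟨⟩-∘ t (var ∘ merge {S} x y z) σ)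
        (substitution (σ ∘ merge {S} x y z) d (closedTyped-embed (merge-embeds Γ'x Γ'y z-fresh Δz rest) closed))
    substitution σ (var-rule (_ , decl , _)) closed = closed _ _ (decl Fin.zero)
    substitution σ (w1 d _) closed = substitution σ d closed
    substitution σ (w2 d Γ'x Δx r≤p rest) closed =
      substitution σ d (closedTyped-embed (raise-embeds Γ'x Δx r≤p rest) closed)
    substitution σ (w3 d q≤s) closed with substitution σ d closed
    ... | k , d' = k , w3 d' q≤s
    substitution σ (w4 d ext) closed = substitution σ d (closedTyped-embed (⊆⇒embeds (ext-⊆ ext)) closed)

-- Lemma 4.
lemma4 : {S : Signature} {R : TRS {S}} (A : AnnSig R)
    (Γ : Ctx {S}) (σ : Subst {S}) (t : Term {S}) (q : Res) →
    Normalised R σ → Consistent A σ Γ →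
    _⊢_∶_ A Γ t q →
    _⊢_∶_ A (∅ {S}) (t ⟨ σ ⟩) q
lemma4 A Γ σ t q _ consistent (_ , d) = substitution A σ d closed
  where
    closed : ClosedTyped A σ Γ
    closed = consistent⇒closedTyped A (proj₂ (derivable⇒bounded A d)) consistent
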